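{- Let $U$ be a finite set with a metric $d$, and let $g:2^U\to\mathbb{R}$ be either a normalized, non-negative, monotone submodular function or a weakly submodular function. Then $f(S)=g(S)+\sum_{\{u,v\}\subseteq S,\,u\neq v}d(u,v)$ is weakly submodular.
   Context: A normalized ($f(\emptyset)=0$), non-negative set function $f$ on a finite universe $U$ is called weakly submodular if for all $S,T\subseteq U$: $|T|f(S)+|S|f(T)\ge |S\cap T|\,f(S\cup T)+|S\cup T|\,f(S\cap T)$. Submodular means $g(S)+g(T)\ge g(S\cup T)+g(S\cap T)$ for all $S,T$. -}

module Defs where

open import Level using (Level; _⊔_; suc)
open import Data.Nat.Base as ℕ using (ℕ; _<ᵇ_)
open import Data.Bool.Base using (Bool; true; false; _∧_; if_then_else_)
open import Data.Fin.Base using (Fin; toℕ)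
open import Data.Fin.Subset using (Subset; _⊆_; _∪_; _∩_; ∣_∣; ⊥)
open import Data.Vec.Base using (lookup)
open import Data.Product.Base using (_×_)
open import Relation.Binary.PropositionalEquality using (_≡_)
open import Algebra.Bundles using (CommutativeRing)
open import Relation.Binary.Core using (Rel)
open import Relation.Binary.Structures using (IsTotalOrder)
import Algebra.Definitions.RawMonoid as RawMonoidDefs

-- An ordered commutative ring (standard definition): a commutative ring
-- with a total order compatible with addition and with multiplication of
-- non-negative elements.  ℝ is an instance; the statement is proved for
-- all such rings, hence in particular for real-valued functions.
record OrderedCommutativeRing (c ℓ ℓ₂ : Level) : Set (suc (c ⊔ ℓ ⊔ ℓ₂)) where
  field
    commutativeRing : CommutativeRing c ℓ
  open CommutativeRing commutativeRing public
  field
    _≤_          : Rel Carrier ℓ₂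
    isTotalOrder : IsTotalOrder _≈_ _≤_
    +-mono-≤     : ∀ {a b} (c : Carrier) → a ≤ b → (a + c) ≤ (b + c)
    *-nonneg     : ∀ {a b} → 0# ≤ a → 0# ≤ b → 0# ≤ (a * b)

module SetFunctions {c ℓ ℓ₂ : Level} (R : OrderedCommutativeRing c ℓ ℓ₂) where
  open OrderedCommutativeRing R
  open RawMonoidDefs +-rawMonoid public using (sum) renaming (_×_ to _·ℕ_)


  record IsMetric {n : ℕ} (d : Fin n → Fin n → Carrier) : Set (c ⊔ ℓ ⊔ ℓ₂) where
    field
      zero-iff-eq : ∀ x y → (d x y ≈ 0# → x ≡ y) × (x ≡ y → d x y ≈ 0#)
      symmetric   : ∀ x y → d x y ≈ d y x
      triangle    : ∀ x y z → d x z ≤ (d x y + d y z)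

  Normalized : {n : ℕ} → (Subset n → Carrier) → Set ℓ
  Normalized g = g ⊥ ≈ 0#

  NonNegative : {n : ℕ} → (Subset n → Carrier) → Set ℓ₂
  NonNegative g = ∀ S → 0# ≤ g S

  Monotone : {n : ℕ} → (Subset n → Carrier) → Set ℓ₂
  Monotone g = ∀ {S T} → S ⊆ T → g S ≤ g T

  Submodular : {n : ℕ} → (Subset n → Carrier) → Set ℓ₂
  Submodular g = ∀ S T → (g (S ∪ T) + g (S ∩ T)) ≤ (g S + g T)

  WeakSubmodularInequality : {n : ℕ} → (Subset n → Carrier) → Set ℓ₂
  WeakSubmodularInequality f =
    ∀ S T → ((∣ S ∩ T ∣ ·ℕ f (S ∪ T)) + (∣ S ∪ T ∣ ·ℕ f (S ∩ T)))
              ≤ ((∣ T ∣ ·ℕ f S) + (∣ S ∣ ·ℕ f T))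

  WeaklySubmodular : {n : ℕ} → (Subset n → Carrier) → Set (ℓ ⊔ ℓ₂)
  WeaklySubmodular f = Normalized f × NonNegative f × WeakSubmodularInequality f

  NormNonnegMonotoneSubmodular : {n : ℕ} → (Subset n → Carrier) → Set (ℓ ⊔ ℓ₂)
  NormNonnegMonotoneSubmodular g =
    Normalized g × NonNegative g × Monotone g × Submodular g

  pairSum : {n : ℕ} → (Fin n → Fin n → Carrier) → Subset n → Carrier
  pairSum d S =
    sum (λ i → sum (λ j →
      if (lookup S i ∧ lookup S j ∧ (toℕ i <ᵇ toℕ j)) then d i j else 0#))

  addDispersion : {n : ℕ} → (Fin n → Fin n → Carrier) → (Subset n → Carrier)
                → Subset n → Carrier
  addDispersion d g S = g S + pairSum d S

-- Write d(X, Y) for the sum of d over X × Y, and let A = S ∖ T, B = T ∖ S,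
-- C = S ∩ T with a, b, c their sizes.  For the ordered pair sum
-- Q(X) = d(X, X) the weak-submodularity defect is
--   |T| Q(S) + |S| Q(T) − |S∩T| Q(S∪T) − |S∪T| Q(S∩T)
--     = b d(A,A) + a d(B,B) + 2 (b d(A,C) + a d(B,C) − c d(A,B)),
-- and c d(A,B) ≤ b d(A,C) + a d(C,B) is the triangle inequality
-- d(x,y) ≤ d(x,z) + d(z,y) summed over x ∈ A, y ∈ B, z ∈ C.  Formally this
-- bookkeeping is carried out on triple sums over (z; x, y), whose
-- natural-number coefficients are compared on all 2⁶ membership patterns of
-- z, x, y.  The dispersion sum counts every pair once,
-- so it is Q/2; a monotone submodular g satisfies the inequality pointwise in
-- the elements of the universe; and the inequality is closed under sums.

module Submission where

open import Defs
open import Level using (Level)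
open import Data.Bool.Base using (Bool; true; false; _∧_; _∨_; not; if_then_else_)
open import Data.Empty using (⊥-elim)
open import Data.Fin.Base using (Fin; zero; suc; toℕ)
import Data.Fin.Properties as Finₚ
open import Data.Fin.Subset using (Subset; _∩_; _∪_; ∣_∣; ⊥)
open import Data.Fin.Subset.Properties using (p∩q⊆p; p∩q⊆q)
open import Data.Nat.Base as ℕ using (ℕ; _<ᵇ_)
import Data.Nat.Properties as ℕ
open import Data.Product.Base using (_,_; proj₂)
open import Data.Sum.Base using (_⊎_; inj₁; inj₂; [_,_]′)
open import Function.Base using (id)
open import Data.Vec.Base using ([]; _∷_; lookup)
open import Data.Vec.Properties using (lookup-zipWith; lookup-replicate)
open import Relation.Binary.Bundles using (Poset)
open import Relation.Binary.PropositionalEquality as ≡ using (_≡_)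
open import Relation.Binary.Structures using (IsTotalOrder)
open import Relation.Nullary.Decidable using (Dec; yes; no; toWitness)
open import Relation.Nullary.Reflects using (ofʸ; ofⁿ)
open import Relation.Unary using (Decidable)
import Algebra.Properties.CommutativeMonoid.Mult as CommutativeMonoidMult
import Algebra.Properties.CommutativeMonoid.Sum as CommutativeMonoidSum
import Algebra.Properties.CommutativeSemigroup as CommutativeSemigroupProperties
import Relation.Binary.Reasoning.PartialOrder as PartialOrderReasoning

𝟙 : Bool → ℕ
𝟙 true  = 1
𝟙 false = 0

∀-Bool? : ∀ {p} {P : Bool → Set p} → Decidable P → Dec (∀ b → P b)
∀-Bool? P? with P? true | P? false
... | yes p | yes q = yes λ { true → p ; false → q }
... | no ¬p | _     = no λ h → ¬p (h true)
... | _     | no ¬q = no λ h → ¬q (h false)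

onlyˡ onlyʳ : Bool → Bool → Bool
onlyˡ s t = s ∧ not t
onlyʳ s t = not s ∧ t

-- The coefficient of d(x, y) in a triple sum over (z; x, y), as a function of
-- the memberships z ∈ S, z ∈ T, x ∈ S, x ∈ T, y ∈ S, y ∈ T.
Coefficient : Set
Coefficient = Bool → Bool → Bool → Bool → Bool → Bool → ℕ

infixl 6 _⊕_
_⊕_ : Coefficient → Coefficient → Coefficient
(f ⊕ g) sz tz sx tx sy ty = f sz tz sx tx sy ty ℕ.+ g sz tz sx tx sy ty

rotate swap : Coefficient → Coefficient
rotate f sz tz sx tx sy ty = f sy ty sx tx sz tz
swap   f sz tz sx tx sy ty = f sx tx sz tz sy ty

infix 4 _≗⁶_
_≗⁶_ : Coefficient → Coefficient → Set
f ≗⁶ g = ∀ sz tz sx tx sy ty → f sz tz sx tx sy ty ≡ g sz tz sx tx sy ty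

_≗⁶?_ : (f g : Coefficient) → Dec (f ≗⁶ g)
f ≗⁶? g = ∀-Bool? λ sz → ∀-Bool? λ tz → ∀-Bool? λ sx → ∀-Bool? λ tx →
          ∀-Bool? λ sy → ∀-Bool? λ ty → f sz tz sx tx sy ty ℕ.≟ g sz tz sx tx sy ty

-- sidesWeight and meetJoinWeight are the coefficients of the two sides of the
-- weak-submodularity inequality for Q; detourWeight selects z ∈ S ∩ T with
-- x, y on opposite sides of S △ T, the triples where the triangle inequality
-- through z is used.
sidesWeight meetJoinWeight detourWeight excessWeight : Coefficient
sidesWeight sz tz sx tx sy ty = 𝟙 tz ℕ.* 𝟙 (sx ∧ sy) ℕ.+ 𝟙 sz ℕ.* 𝟙 (tx ∧ ty)
meetJoinWeight sz tz sx tx sy ty =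
  𝟙 (sz ∧ tz) ℕ.* 𝟙 ((sx ∨ tx) ∧ (sy ∨ ty)) ℕ.+ 𝟙 (sz ∨ tz) ℕ.* 𝟙 ((sx ∧ tx) ∧ (sy ∧ ty))
detourWeight sz tz sx tx sy ty =
  𝟙 ((sz ∧ tz) ∧ ((onlyˡ sx tx ∧ onlyʳ sy ty) ∨ (onlyʳ sx tx ∧ onlyˡ sy ty)))
excessWeight sz tz sx tx sy ty =
  𝟙 ((onlyʳ sz tz ∧ onlyˡ sx tx ∧ onlyˡ sy ty) ∨ (onlyˡ sz tz ∧ onlyʳ sx tx ∧ onlyʳ sy ty))

weight-identity :
  sidesWeight ⊕ detourWeight ≗⁶
  meetJoinWeight ⊕ (rotate detourWeight ⊕ swap detourWeight) ⊕ excessWeight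
weight-identity = toWitness {a? = _ ≗⁶? _} _

onSubsets : ∀ {n} → Subset n → Subset n → Coefficient → Fin n → Fin n → Fin n → ℕ
onSubsets S T w z x y =
  w (lookup S z) (lookup T z) (lookup S x) (lookup T x) (lookup S y) (lookup T y)

module OrderedCommutativeRingProperties {c ℓ ℓ₂ : Level} (R : OrderedCommutativeRing c ℓ ℓ₂) where

  open OrderedCommutativeRing R hiding (zero) renaming (+-mono-≤ to +-monoˡ-≤; _≤_ to infix 4 _≤_)
  open SetFunctions R using (_·ℕ_; sum)
  open CommutativeMonoidSum +-commutativeMonoid using (∑-distrib-+; ∑-comm; sum-cong-≋; sum-replicate-zero)

  poset : Poset c ℓ ℓ₂
  poset = record { isPartialOrder = IsTotalOrder.isPartialOrder isTotalOrder }

  open Poset poset public using () renaming (refl to ≤-refl)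
  open PartialOrderReasoning poset

  +-monoʳ-≤ : ∀ {a b} x → a ≤ b → x + a ≤ x + b
  +-monoʳ-≤ {a} {b} x a≤b = begin
    x + a ≈⟨ +-comm x a ⟩
    a + x ≤⟨ +-monoˡ-≤ x a≤b ⟩
    b + x ≈⟨ +-comm b x ⟩
    x + b ∎

  +-mono-≤ : ∀ {a b x y} → a ≤ b → x ≤ y → a + x ≤ b + y
  +-mono-≤ {b = b} {x = x} a≤b x≤y = begin
    _     ≤⟨ +-monoˡ-≤ x a≤b ⟩
    b + x ≤⟨ +-monoʳ-≤ b x≤y ⟩
    _     ∎

  +-nonneg : ∀ {a b} → 0# ≤ a → 0# ≤ b → 0# ≤ a + b
  +-nonneg 0≤a 0≤b = begin
    0#      ≈⟨ +-identityʳ 0# ⟨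
    0# + 0# ≤⟨ +-mono-≤ 0≤a 0≤b ⟩
    _       ∎

  x≤x+y : ∀ {x y} → 0# ≤ y → x ≤ x + y
  x≤x+y {x} 0≤y = begin
    x      ≈⟨ +-identityʳ x ⟨
    x + 0# ≤⟨ +-monoʳ-≤ x 0≤y ⟩
    _      ∎

  +-cancelʳ-≤ : ∀ {a b} x → a + x ≤ b + x → a ≤ b
  +-cancelʳ-≤ {a} {b} x a+x≤b+x = begin
    a              ≈⟨ +-identityʳ a ⟨
    a + 0#         ≈⟨ +-congˡ (-‿inverseʳ x) ⟨
    a + (x - x)    ≈⟨ +-assoc a x (- x) ⟨
    (a + x) - x    ≤⟨ +-monoˡ-≤ (- x) a+x≤b+x ⟩
    (b + x) - x    ≈⟨ +-assoc b x (- x) ⟩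
    b + (x - x)    ≈⟨ +-congˡ (-‿inverseʳ x) ⟩
    b + 0#         ≈⟨ +-identityʳ b ⟩
    b              ∎

  x+x≤y+y⇒x≤y : ∀ {x y} → x + x ≤ y + y → x ≤ y
  x+x≤y+y⇒x≤y {x} {y} 2x≤2y with IsTotalOrder.total isTotalOrder x y
  ... | inj₁ x≤y = x≤y
  ... | inj₂ y≤x = +-cancelʳ-≤ y (begin
    x + y ≤⟨ +-monoʳ-≤ x y≤x ⟩
    x + x ≤⟨ 2x≤2y ⟩
    y + y ∎)

  ×-nonneg : ∀ k {x} → 0# ≤ x → 0# ≤ k ·ℕ x
  ×-nonneg ℕ.zero    0≤x = ≤-refl
  ×-nonneg (ℕ.suc k) 0≤x = +-nonneg 0≤x (×-nonneg k 0≤x)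

  ×-monoʳ-≤ : ∀ k {x y} → x ≤ y → k ·ℕ x ≤ k ·ℕ y
  ×-monoʳ-≤ ℕ.zero    x≤y = ≤-refl
  ×-monoʳ-≤ (ℕ.suc k) x≤y = +-mono-≤ x≤y (×-monoʳ-≤ k x≤y)

  ×-distrib-sum : ∀ k {m} (f : Fin m → Carrier) → k ·ℕ sum f ≈ sum (λ i → k ·ℕ f i)
  ×-distrib-sum ℕ.zero    {m} f = sym (sum-replicate-zero m)
  ×-distrib-sum (ℕ.suc k)     f = trans (+-congˡ (×-distrib-sum k f)) (sym (∑-distrib-+ f _))

  sum-mono-≤ : ∀ {m} {f g : Fin m → Carrier} → (∀ i → f i ≤ g i) → sum f ≤ sum g
  sum-mono-≤ {ℕ.zero}  f≤g = ≤-refl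
  sum-mono-≤ {ℕ.suc m} f≤g = +-mono-≤ (f≤g zero) (sum-mono-≤ (λ i → f≤g (suc i)))

  sum-nonneg : ∀ {m} {f : Fin m → Carrier} → (∀ i → 0# ≤ f i) → 0# ≤ sum f
  sum-nonneg {m} 0≤f = begin
    0#                 ≈⟨ sum-replicate-zero m ⟨
    sum (λ (_ : Fin m) → 0#) ≤⟨ sum-mono-≤ 0≤f ⟩
    _                  ∎

  card-×-sum : ∀ {m} (P : Subset m) x → ∣ P ∣ ·ℕ x ≈ sum (λ z → 𝟙 (lookup P z) ·ℕ x)
  card-×-sum []          x = refl
  card-×-sum (true ∷ P)  x = +-cong (sym (+-identityʳ x)) (card-×-sum P x)
  card-×-sum (false ∷ P) x = trans (card-×-sum P x) (sym (+-identityˡ _))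

  module _ {n : ℕ} where

    ∑³ : (Fin n → Fin n → Fin n → Carrier) → Carrier
    ∑³ F = sum λ z → sum λ x → sum λ y → F z x y

    ∑³-cong : ∀ {F G} → (∀ z x y → F z x y ≈ G z x y) → ∑³ F ≈ ∑³ G
    ∑³-cong F≈G = sum-cong-≋ λ z → sum-cong-≋ λ x → sum-cong-≋ λ y → F≈G z x y

    ∑³-mono-≤ : ∀ {F G} → (∀ z x y → F z x y ≤ G z x y) → ∑³ F ≤ ∑³ G
    ∑³-mono-≤ F≤G = sum-mono-≤ λ z → sum-mono-≤ λ x → sum-mono-≤ λ y → F≤G z x y

    ∑³-nonneg : ∀ {F} → (∀ z x y → 0# ≤ F z x y) → 0# ≤ ∑³ F
    ∑³-nonneg 0≤F = sum-nonneg λ z → sum-nonneg λ x → sum-nonneg λ y → 0≤F z x y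

    ∑³-distrib-+ : ∀ F G → ∑³ (λ z x y → F z x y + G z x y) ≈ ∑³ F + ∑³ G
    ∑³-distrib-+ F G = trans
      (sum-cong-≋ λ z → trans (sum-cong-≋ λ x → ∑-distrib-+ (F z x) (G z x))
                               (∑-distrib-+ (λ x → sum (F z x)) (λ x → sum (G z x))))
      (∑-distrib-+ (λ z → sum λ x → sum (F z x)) (λ z → sum λ x → sum (G z x)))

    ∑³-rotate : ∀ F → ∑³ F ≈ ∑³ (λ z x y → F y x z)
    ∑³-rotate F = trans (sum-cong-≋ λ z → ∑-comm (F z))
                 (trans (∑-comm (λ z y → sum λ x → F z x y))
                        (sum-cong-≋ λ y → ∑-comm (λ z x → F z x y)))

    ∑³-swap : ∀ F → ∑³ F ≈ ∑³ (λ z x y → F x z y)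
    ∑³-swap F = ∑-comm (λ z x → sum λ y → F z x y)

module WeakSubmodularity {c ℓ ℓ₂ : Level} (R : OrderedCommutativeRing c ℓ ℓ₂) where

  open OrderedCommutativeRing R hiding (zero) renaming (+-mono-≤ to +-monoˡ-≤; _≤_ to infix 4 _≤_)
  open SetFunctions R
  open CommutativeMonoidMult +-commutativeMonoid using (×-congʳ; ×-congˡ; ×-homo-+; ×-assocˡ; ×-distrib-+)
  open CommutativeMonoidSum +-commutativeMonoid using (∑-distrib-+; ∑-comm; sum-cong-≋; sum-replicate-zero)
  open CommutativeSemigroupProperties +-commutativeSemigroup using (interchange)
  open OrderedCommutativeRingProperties R
  open PartialOrderReasoning poset

  monotone∧submodular⇒weakSubmodular : ∀ {n} {g : Subset n → Carrier} →
    Monotone g → Submodular g → WeakSubmodularInequality g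
  monotone∧submodular⇒weakSubmodular {g = g} mono sub S T = begin
    ∣ C ∣ ·ℕ g U + ∣ U ∣ ·ℕ g C
      ≈⟨ +-cong (card-×-sum C (g U)) (card-×-sum U (g C)) ⟩
    sum (λ z → 𝟙 (lookup C z) ·ℕ g U) + sum (λ z → 𝟙 (lookup U z) ·ℕ g C)
      ≈⟨ ∑-distrib-+ (λ z → 𝟙 (lookup C z) ·ℕ g U) (λ z → 𝟙 (lookup U z) ·ℕ g C) ⟨
    sum (λ z → 𝟙 (lookup C z) ·ℕ g U + 𝟙 (lookup U z) ·ℕ g C)
      ≤⟨ sum-mono-≤ pointwise ⟩
    sum (λ z → 𝟙 (lookup T z) ·ℕ g S + 𝟙 (lookup S z) ·ℕ g T)
      ≈⟨ ∑-distrib-+ (λ z → 𝟙 (lookup T z) ·ℕ g S) (λ z → 𝟙 (lookup S z) ·ℕ g T) ⟩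
    sum (λ z → 𝟙 (lookup T z) ·ℕ g S) + sum (λ z → 𝟙 (lookup S z) ·ℕ g T)
      ≈⟨ +-cong (card-×-sum T (g S)) (card-×-sum S (g T)) ⟨
    ∣ T ∣ ·ℕ g S + ∣ S ∣ ·ℕ g T ∎
    where
    C = S ∩ T
    U = S ∪ T

    pointwise : ∀ z → 𝟙 (lookup C z) ·ℕ g U + 𝟙 (lookup U z) ·ℕ g C
                    ≤ 𝟙 (lookup T z) ·ℕ g S + 𝟙 (lookup S z) ·ℕ g T
    pointwise z rewrite lookup-zipWith _∧_ z S T | lookup-zipWith _∨_ z S T
      with lookup S z | lookup T z
    ... | true  | true  = begin
      (g U + 0#) + (g C + 0#) ≈⟨ +-cong (+-identityʳ _) (+-identityʳ _) ⟩
      g U + g C               ≤⟨ sub S T ⟩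
      g S + g T               ≈⟨ +-cong (+-identityʳ _) (+-identityʳ _) ⟨
      (g S + 0#) + (g T + 0#) ∎
    ... | true  | false = +-monoʳ-≤ 0# (+-monoˡ-≤ 0# (mono (p∩q⊆q S T)))
    ... | false | true  = begin
      0# + (g C + 0#) ≈⟨ +-comm _ _ ⟩
      (g C + 0#) + 0# ≤⟨ +-monoˡ-≤ 0# (+-monoˡ-≤ 0# (mono (p∩q⊆p S T))) ⟩
      (g S + 0#) + 0# ∎
    ... | false | false = ≤-refl

  monotoneSubmodular⇒weaklySubmodular : ∀ {n} {g : Subset n → Carrier} →
    NormNonnegMonotoneSubmodular g → WeaklySubmodular g
  monotoneSubmodular⇒weaklySubmodular (normalized , nonneg , mono , sub) =
    normalized , nonneg , monotone∧submodular⇒weakSubmodular mono sub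

  +-weakSubmodular : ∀ {n} {f g : Subset n → Carrier} →
    WeakSubmodularInequality f → WeakSubmodularInequality g →
    WeakSubmodularInequality (λ X → f X + g X)
  +-weakSubmodular {f = f} {g} f-weak g-weak S T = begin
    ∣ S ∩ T ∣ ·ℕ (f U + g U) + ∣ S ∪ T ∣ ·ℕ (f C + g C)
      ≈⟨ +-cong (×-distrib-+ (f U) (g U) ∣ S ∩ T ∣) (×-distrib-+ (f C) (g C) ∣ S ∪ T ∣) ⟩
    (∣ S ∩ T ∣ ·ℕ f U + ∣ S ∩ T ∣ ·ℕ g U) + (∣ S ∪ T ∣ ·ℕ f C + ∣ S ∪ T ∣ ·ℕ g C)
      ≈⟨ interchange _ _ _ _ ⟩
    (∣ S ∩ T ∣ ·ℕ f U + ∣ S ∪ T ∣ ·ℕ f C) + (∣ S ∩ T ∣ ·ℕ g U + ∣ S ∪ T ∣ ·ℕ g C)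
      ≤⟨ +-mono-≤ (f-weak S T) (g-weak S T) ⟩
    (∣ T ∣ ·ℕ f S + ∣ S ∣ ·ℕ f T) + (∣ T ∣ ·ℕ g S + ∣ S ∣ ·ℕ g T)
      ≈⟨ interchange _ _ _ _ ⟩
    (∣ T ∣ ·ℕ f S + ∣ T ∣ ·ℕ g S) + (∣ S ∣ ·ℕ f T + ∣ S ∣ ·ℕ g T)
      ≈⟨ +-cong (×-distrib-+ (f S) (g S) ∣ T ∣) (×-distrib-+ (f T) (g T) ∣ S ∣) ⟨
    ∣ T ∣ ·ℕ (f S + g S) + ∣ S ∣ ·ℕ (f T + g T) ∎
    where
    C = S ∩ T
    U = S ∪ T

  weakSubmodular-halve : ∀ {n} {f h : Subset n → Carrier} → (∀ X → h X ≈ f X + f X) →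
    WeakSubmodularInequality h → WeakSubmodularInequality f
  weakSubmodular-halve {f = f} {h} h≈f+f h-weak S T = x+x≤y+y⇒x≤y (begin
    (a + b) + (a + b) ≈⟨ interchange a b a b ⟩
    (a + a) + (b + b) ≈⟨ +-cong (double ∣ S ∩ T ∣ (S ∪ T)) (double ∣ S ∪ T ∣ (S ∩ T)) ⟨
    ∣ S ∩ T ∣ ·ℕ h (S ∪ T) + ∣ S ∪ T ∣ ·ℕ h (S ∩ T) ≤⟨ h-weak S T ⟩
    ∣ T ∣ ·ℕ h S + ∣ S ∣ ·ℕ h T ≈⟨ +-cong (double ∣ T ∣ S) (double ∣ S ∣ T) ⟩
    (e + e) + (e′ + e′) ≈⟨ interchange e e e′ e′ ⟩
    (e + e′) + (e + e′) ∎)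
    where
    a = ∣ S ∩ T ∣ ·ℕ f (S ∪ T)
    b = ∣ S ∪ T ∣ ·ℕ f (S ∩ T)
    e = ∣ T ∣ ·ℕ f S
    e′ = ∣ S ∣ ·ℕ f T

    double : ∀ k X → k ·ℕ h X ≈ k ·ℕ f X + k ·ℕ f X
    double k X = trans (×-congʳ k (h≈f+f X)) (×-distrib-+ (f X) (f X) k)

  module _ {n : ℕ} (d : Fin n → Fin n → Carrier) where

    orderedPairSum : Subset n → Carrier
    orderedPairSum X = sum λ x → sum λ y → 𝟙 (lookup X x ∧ lookup X y) ·ℕ d x y

    weighted : (Fin n → Fin n → Fin n → ℕ) → Carrier
    weighted K = ∑³ λ z x y → K z x y ·ℕ d x y

    weighted-+ : ∀ K L → weighted (λ z x y → K z x y ℕ.+ L z x y) ≈ weighted K + weighted L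
    weighted-+ K L = trans (∑³-cong λ z x y → ×-homo-+ (d x y) (K z x y) (L z x y))
                           (∑³-distrib-+ (λ z x y → K z x y ·ℕ d x y) (λ z x y → L z x y ·ℕ d x y))

    weighted-cong : ∀ {K L} → (∀ z x y → K z x y ≡ L z x y) → weighted K ≈ weighted L
    weighted-cong K≡L = ∑³-cong λ z x y → ×-congˡ (K≡L z x y)

    weighted-nonneg : (∀ x y → 0# ≤ d x y) → ∀ K → 0# ≤ weighted K
    weighted-nonneg 0≤d K = ∑³-nonneg λ z x y → ×-nonneg (K z x y) (0≤d x y)

    weighted-triangle : (∀ x y z → d x z ≤ d x y + d y z) → ∀ K →
      weighted K ≤ weighted (λ z x y → K y x z) + weighted (λ z x y → K x z y)
    weighted-triangle triangle K = begin
      weighted K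
        ≤⟨ ∑³-mono-≤ (λ z x y → ×-monoʳ-≤ (K z x y) (triangle x z y)) ⟩
      ∑³ (λ z x y → K z x y ·ℕ (d x z + d z y))
        ≈⟨ ∑³-cong (λ z x y → ×-distrib-+ (d x z) (d z y) (K z x y)) ⟩
      ∑³ (λ z x y → K z x y ·ℕ d x z + K z x y ·ℕ d z y)
        ≈⟨ ∑³-distrib-+ (λ z x y → K z x y ·ℕ d x z) (λ z x y → K z x y ·ℕ d z y) ⟩
      ∑³ (λ z x y → K z x y ·ℕ d x z) + ∑³ (λ z x y → K z x y ·ℕ d z y)
        ≈⟨ +-cong (∑³-rotate (λ z x y → K z x y ·ℕ d x z)) (∑³-swap (λ z x y → K z x y ·ℕ d z y)) ⟩
      weighted (λ z x y → K y x z) + weighted (λ z x y → K x z y) ∎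

    card-×-orderedPairSum : ∀ P X →
      ∣ P ∣ ·ℕ orderedPairSum X ≈ weighted (λ z x y → 𝟙 (lookup P z) ℕ.* 𝟙 (lookup X x ∧ lookup X y))
    card-×-orderedPairSum P X = trans (card-×-sum P (orderedPairSum X)) (sum-cong-≋ λ z →
      trans (×-distrib-sum (𝟙 (lookup P z)) (λ x → sum λ y → 𝟙 (lookup X x ∧ lookup X y) ·ℕ d x y))
            (sum-cong-≋ λ x →
      trans (×-distrib-sum (𝟙 (lookup P z)) (λ y → 𝟙 (lookup X x ∧ lookup X y) ·ℕ d x y))
            (sum-cong-≋ λ y →
      ×-assocˡ (d x y) (𝟙 (lookup P z)) (𝟙 (lookup X x ∧ lookup X y)))))

    sides-weighted : ∀ S T → ∣ T ∣ ·ℕ orderedPairSum S + ∣ S ∣ ·ℕ orderedPairSum T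
                             ≈ weighted (onSubsets S T sidesWeight)
    sides-weighted S T = trans
      (+-cong (card-×-orderedPairSum T S) (card-×-orderedPairSum S T))
      (sym (weighted-+ (λ z x y → 𝟙 (lookup T z) ℕ.* 𝟙 (lookup S x ∧ lookup S y))
                       (λ z x y → 𝟙 (lookup S z) ℕ.* 𝟙 (lookup T x ∧ lookup T y))))

    meetJoin-weighted : ∀ S T →
      ∣ S ∩ T ∣ ·ℕ orderedPairSum (S ∪ T) + ∣ S ∪ T ∣ ·ℕ orderedPairSum (S ∩ T)
        ≈ weighted (onSubsets S T meetJoinWeight)
    meetJoin-weighted S T = trans
      (+-cong (card-×-orderedPairSum (S ∩ T) (S ∪ T)) (card-×-orderedPairSum (S ∪ T) (S ∩ T)))
      (trans (sym (weighted-+ (λ z x y → 𝟙 (lookup C z) ℕ.* 𝟙 (lookup U x ∧ lookup U y))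
                              (λ z x y → 𝟙 (lookup U z) ℕ.* 𝟙 (lookup C x ∧ lookup C y))))
             (weighted-cong lookups))
      where
      C = S ∩ T
      U = S ∪ T

      lookups : ∀ z x y →
        𝟙 (lookup C z) ℕ.* 𝟙 (lookup U x ∧ lookup U y) ℕ.+ 𝟙 (lookup U z) ℕ.* 𝟙 (lookup C x ∧ lookup C y)
          ≡ onSubsets S T meetJoinWeight z x y
      lookups z x y
        rewrite lookup-zipWith _∧_ z S T | lookup-zipWith _∨_ z S T
              | lookup-zipWith _∧_ x S T | lookup-zipWith _∨_ x S T
              | lookup-zipWith _∧_ y S T | lookup-zipWith _∨_ y S T = ≡.refl

    orderedPairSum-weakSubmodular : (∀ x y → 0# ≤ d x y) → (∀ x y z → d x z ≤ d x y + d y z) →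
      WeakSubmodularInequality orderedPairSum
    orderedPairSum-weakSubmodular 0≤d triangle S T = begin
      ∣ S ∩ T ∣ ·ℕ orderedPairSum (S ∪ T) + ∣ S ∪ T ∣ ·ℕ orderedPairSum (S ∩ T)
        ≈⟨ meetJoin-weighted S T ⟩
      W meetJoinWeight
        ≤⟨ +-cancelʳ-≤ (W detourWeight) (begin
             W meetJoinWeight + W detourWeight
               ≤⟨ +-monoʳ-≤ _ (weighted-triangle triangle (onSubsets S T detourWeight)) ⟩
             W meetJoinWeight + (W (rotate detourWeight) + W (swap detourWeight))
               ≤⟨ x≤x+y (weighted-nonneg 0≤d (onSubsets S T excessWeight)) ⟩
             W meetJoinWeight + (W (rotate detourWeight) + W (swap detourWeight)) + W excessWeight
               ≈⟨ +-congʳ (+-congˡ (W-⊕ (rotate detourWeight) (swap detourWeight))) ⟨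
             W meetJoinWeight + W (rotate detourWeight ⊕ swap detourWeight) + W excessWeight
               ≈⟨ +-congʳ (W-⊕ meetJoinWeight (rotate detourWeight ⊕ swap detourWeight)) ⟨
             W (meetJoinWeight ⊕ (rotate detourWeight ⊕ swap detourWeight)) + W excessWeight
               ≈⟨ W-⊕ (meetJoinWeight ⊕ (rotate detourWeight ⊕ swap detourWeight)) excessWeight ⟨
             W (meetJoinWeight ⊕ (rotate detourWeight ⊕ swap detourWeight) ⊕ excessWeight)
               ≈⟨ W-≗⁶ weight-identity ⟨
             W (sidesWeight ⊕ detourWeight)
               ≈⟨ W-⊕ sidesWeight detourWeight ⟩
             W sidesWeight + W detourWeight ∎) ⟩
      W sidesWeight
        ≈⟨ sides-weighted S T ⟨
      ∣ T ∣ ·ℕ orderedPairSum S + ∣ S ∣ ·ℕ orderedPairSum T ∎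
      where
      W : Coefficient → Carrier
      W w = weighted (onSubsets S T w)

      W-⊕ : ∀ v w → W (v ⊕ w) ≈ W v + W w
      W-⊕ v w = weighted-+ (onSubsets S T v) (onSubsets S T w)

      W-≗⁶ : ∀ {v w} → v ≗⁶ w → W v ≈ W w
      W-≗⁶ v≗w = weighted-cong λ z x y →
        v≗w (lookup S z) (lookup T z) (lookup S x) (lookup T x) (lookup S y) (lookup T y)

    pairTerm : Subset n → Fin n → Fin n → Carrier
    pairTerm X i j = if lookup X i ∧ lookup X j ∧ (toℕ i <ᵇ toℕ j) then d i j else 0#

    pairSum-⊥ : Normalized (pairSum d)
    pairSum-⊥ = trans (sum-cong-≋ λ i → trans (sum-cong-≋ (vanish i)) (sum-replicate-zero n))
                      (sum-replicate-zero n)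
      where
      vanish : ∀ i j → pairTerm ⊥ i j ≈ 0#
      vanish i j rewrite lookup-replicate i false = refl

    module _ (metric : IsMetric d) where
      open IsMetric metric

      metric-nonneg : ∀ x y → 0# ≤ d x y
      metric-nonneg x y = x+x≤y+y⇒x≤y (begin
        0# + 0#       ≈⟨ +-identityʳ 0# ⟩
        0#            ≈⟨ proj₂ (zero-iff-eq x x) ≡.refl ⟨
        d x x         ≤⟨ triangle x y x ⟩
        d x y + d y x ≈⟨ +-congˡ (symmetric y x) ⟩
        d x y + d x y ∎)

      pairSum-nonneg : NonNegative (pairSum d)
      pairSum-nonneg X = sum-nonneg λ i → sum-nonneg λ j → pairTerm-nonneg i j
        where
        pairTerm-nonneg : ∀ i j → 0# ≤ pairTerm X i j
        pairTerm-nonneg i j with lookup X i ∧ lookup X j ∧ (toℕ i <ᵇ toℕ j)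
        ... | true  = metric-nonneg i j
        ... | false = ≤-refl

      split-by-order : ∀ i j → d i j + 0# ≈
        (if toℕ i <ᵇ toℕ j then d i j else 0#) + (if toℕ j <ᵇ toℕ i then d j i else 0#)
      split-by-order i j
        with toℕ i <ᵇ toℕ j | ℕ.<ᵇ-reflects-< (toℕ i) (toℕ j)
           | toℕ j <ᵇ toℕ i | ℕ.<ᵇ-reflects-< (toℕ j) (toℕ i)
      ... | true  | ofʸ i<j  | true  | ofʸ j<i  = ⊥-elim (ℕ.<-asym i<j j<i)
      ... | true  | _        | false | _        = refl
      ... | false | _        | true  | _        = trans (+-comm (d i j) 0#) (+-congˡ (symmetric i j))
      ... | false | ofⁿ i≮j | false | ofⁿ j≮i
        with Finₚ.toℕ-injective (ℕ.≤-antisym (ℕ.≮⇒≥ j≮i) (ℕ.≮⇒≥ i≮j))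
      ...   | ≡.refl = +-congʳ (proj₂ (zero-iff-eq i i) ≡.refl)

      orderedPairSum≈pairSum+pairSum : ∀ X → orderedPairSum X ≈ pairSum d X + pairSum d X
      orderedPairSum≈pairSum+pairSum X = begin-equality
        orderedPairSum X
          ≈⟨ sum-cong-≋ (λ i → sum-cong-≋ (unordered≈ordered+reversed i)) ⟩
        sum (λ i → sum λ j → pairTerm X i j + pairTerm X j i)
          ≈⟨ sum-cong-≋ (λ i → ∑-distrib-+ (pairTerm X i) (λ j → pairTerm X j i)) ⟩
        sum (λ i → sum (pairTerm X i) + sum λ j → pairTerm X j i)
          ≈⟨ ∑-distrib-+ (λ i → sum (pairTerm X i)) (λ i → sum λ j → pairTerm X j i) ⟩
        pairSum d X + sum (λ i → sum λ j → pairTerm X j i)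
          ≈⟨ +-congˡ (∑-comm (λ i j → pairTerm X j i)) ⟩
        pairSum d X + pairSum d X ∎
        where
        unordered≈ordered+reversed : ∀ i j →
          𝟙 (lookup X i ∧ lookup X j) ·ℕ d i j ≈ pairTerm X i j + pairTerm X j i
        unordered≈ordered+reversed i j with lookup X i | lookup X j
        ... | true  | true  = split-by-order i j
        ... | true  | false = sym (+-identityʳ 0#)
        ... | false | true  = sym (+-identityʳ 0#)
        ... | false | false = sym (+-identityʳ 0#)

      pairSum-weakSubmodular : WeakSubmodularInequality (pairSum d)
      pairSum-weakSubmodular = weakSubmodular-halve orderedPairSum≈pairSum+pairSum
        (orderedPairSum-weakSubmodular metric-nonneg triangle)

      addDispersion-weaklySubmodular : ∀ {g} → WeaklySubmodular g → WeaklySubmodular (addDispersion d g)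
      addDispersion-weaklySubmodular (g-normalized , g-nonneg , g-weak) =
          trans (+-cong g-normalized pairSum-⊥) (+-identityʳ 0#)
        , (λ X → +-nonneg (g-nonneg X) (pairSum-nonneg X))
        , +-weakSubmodular g-weak pairSum-weakSubmodular

corollary2 : ∀ {c ℓ ℓ₂ : Level} (R : OrderedCommutativeRing c ℓ ℓ₂) (n : ℕ)
    → (d : Fin n → Fin n → OrderedCommutativeRing.Carrier R)
    → SetFunctions.IsMetric R d
    → (g : Subset n → OrderedCommutativeRing.Carrier R)
    → SetFunctions.NormNonnegMonotoneSubmodular R g ⊎ SetFunctions.WeaklySubmodular R g
    → SetFunctions.WeaklySubmodular R (SetFunctions.addDispersion R d g)
corollary2 R n d metric g g-hyp =
  addDispersion-weaklySubmodular d metric ([ monotoneSubmodular⇒weaklySubmodular , id ]′ g-hyp)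
  where open WeakSubmodularity R
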